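{- Let $\Gamma=(V,E)$ be a finite simple unweighted digraph of order $n$ with adjacency matrix $A=[a_{ij}]_{i,j=1}^n$. Then $\Gamma$ is normal if and only if $\Gamma$ is balanced and $$(a_{ij}-a_{ji})\big(d^+(j)-d^+(i)\big)=\sum_{k\neq i,j}\big(a_{ik}a_{jk}-a_{ki}a_{kj}\big)$$ for all $i\neq j\in V$.
   Context: $V=\{1,\dots,n\}$, $E\subseteq V\times V$ without loops, $a_{ij}=1$ if $(i,j)\in E$ and $0$ otherwise; $d^+(i)$ is the out-degree of $i$. The Laplacian is $L=D-A$ with $D=\mathrm{diag}(d^+(1),\dots,d^+(n))$. $\Gamma$ is normal if $L$ is a normal matrix, and balanced if every vertex has in-degree equal to out-degree. -}

module Defs where

open import Data.Nat using (ℕ; zero; suc)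
open import Data.Fin using (Fin; zero; suc)
open import Data.Bool using (Bool; true; false)
open import Data.Integer using (ℤ; +_; _+_; _-_; _*_; 0ℤ; 1ℤ)
open import Relation.Binary.PropositionalEquality using (_≡_)
open import Relation.Nullary using (¬_; yes; no)
open import Data.Fin using (_≟_)

∑ : {n : ℕ} → (Fin n → ℤ) → ℤ
∑ {zero}  f = 0ℤ
∑ {suc n} f = f zero + ∑ (λ i → f (suc i))

record Digraph (n : ℕ) : Set where
  field
    edge   : Fin n → Fin n → Bool
    noLoop : ∀ i → edge i i ≡ false
open Digraph public

bool→ℤ : Bool → ℤ
bool→ℤ true  = 1ℤ
bool→ℤ false = 0ℤ

adj : {n : ℕ} → Digraph n → Fin n → Fin n → ℤ
adj Γ i j = bool→ℤ (edge Γ i j)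

outdeg : {n : ℕ} → Digraph n → Fin n → ℤ
outdeg Γ i = ∑ (λ j → adj Γ i j)

indeg : {n : ℕ} → Digraph n → Fin n → ℤ
indeg Γ i = ∑ (λ j → adj Γ j i)

δ : {n : ℕ} → Fin n → Fin n → ℤ
δ i j with i ≟ j
... | yes _ = 1ℤ
... | no _  = 0ℤ

laplacian : {n : ℕ} → Digraph n → Fin n → Fin n → ℤ
laplacian Γ i j = δ i j * outdeg Γ i - adj Γ i j

Matrix : ℕ → Set
Matrix n = Fin n → Fin n → ℤ

transpose : {n : ℕ} → Matrix n → Matrix n
transpose M i j = M j i

_·_ : {n : ℕ} → Matrix n → Matrix n → Matrix n
(M · N) i j = ∑ (λ k → M i k * N k j)

-- a real matrix M is normal iff M Mᵀ = Mᵀ M (conjugate transpose = transpose)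
IsNormalMatrix : {n : ℕ} → Matrix n → Set
IsNormalMatrix M = ∀ i j → (M · transpose M) i j ≡ (transpose M · M) i j

IsNormal : {n : ℕ} → Digraph n → Set
IsNormal Γ = IsNormalMatrix (laplacian Γ)

IsBalanced : {n : ℕ} → Digraph n → Set
IsBalanced Γ = ∀ i → indeg Γ i ≡ outdeg Γ i

∑≠ : {n : ℕ} → Fin n → Fin n → (Fin n → ℤ) → ℤ
∑≠ i j f = ∑ (λ k → (1ℤ - δ k i) * (1ℤ - δ k j) * f k)

Condition : {n : ℕ} → Digraph n → Set
Condition Γ = ∀ i j → ¬ (i ≡ j) →
  (adj Γ i j - adj Γ j i) * (outdeg Γ j - outdeg Γ i)
    ≡ ∑≠ i j (λ k → adj Γ i k * adj Γ j k - adj Γ k i * adj Γ k j)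

{-# OPTIONS --safe #-}
-- Write L = D − A. Expanding both products, the terms involving D² cancel and
--   (L Lᵀ − Lᵀ L)ᵢⱼ = (A Aᵀ − Aᵀ A)ᵢⱼ − (aᵢⱼ − aⱼᵢ)(d⁺(j) − d⁺(i)).
-- On the diagonal the correction term vanishes and, the entries being 0/1,
-- (A Aᵀ)ᵢᵢ = d⁺(i) and (Aᵀ A)ᵢᵢ = d⁻(i), so normality there is balance. Off the
-- diagonal it is the stated condition: the summands k = i, j of (A Aᵀ − Aᵀ A)ᵢⱼ
-- vanish because Γ has no loops.
module Submission where

open import Defs
open import Data.Nat using (ℕ)
open import Data.Product using (_×_)
open import Function.Bundles using (_⇔_)

open import Data.Bool using (Bool; true; false)
open import Data.Nat using (zero; suc)
open import Data.Empty using (⊥-elim)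
open import Data.Fin using (Fin; zero; suc; _≟_)
open import Data.Integer using (ℤ; _+_; _-_; _*_; 0ℤ; 1ℤ)
open import Data.Integer.Properties
  using (+-identityˡ; +-identityʳ; *-identityˡ; *-zeroʳ; +-inverseʳ; i-j≡0⇒i≡j)
open import Data.Integer.Tactic.RingSolver using (solve-∀)
open import Data.Product using (_,_)
open import Data.Product.Function.NonDependent.Propositional using (_×-⇔_)
open import Function using (_∘_; case_of_)
open import Function.Bundles using (mk⇔)
open import Function.Properties.Equivalence using () renaming (trans to ⇔-trans)
open import Relation.Binary.PropositionalEquality
  using (_≡_; _≢_; refl; sym; trans; cong; cong₂; module ≡-Reasoning)
open import Relation.Nullary using (yes; no)

private
  variable
    n : ℕ

∑-cong : {f g : Fin n → ℤ} → (∀ k → f k ≡ g k) → ∑ f ≡ ∑ g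
∑-cong {zero}  f≗g = refl
∑-cong {suc n} f≗g = cong₂ _+_ (f≗g zero) (∑-cong (f≗g ∘ suc))

∑-zero : (f : Fin n → ℤ) → (∀ k → f k ≡ 0ℤ) → ∑ f ≡ 0ℤ
∑-zero {zero}  f f≗0 = refl
∑-zero {suc n} f f≗0 = cong₂ _+_ (f≗0 zero) (∑-zero (f ∘ suc) (f≗0 ∘ suc))

∑-distrib-+ : (f g : Fin n → ℤ) → ∑ (λ k → f k + g k) ≡ ∑ f + ∑ g
∑-distrib-+ {zero}  f g = refl
∑-distrib-+ {suc n} f g =
  trans (cong (f zero + g zero +_) (∑-distrib-+ (f ∘ suc) (g ∘ suc)))
        (interchange (f zero) (g zero) (∑ (f ∘ suc)) (∑ (g ∘ suc)))
  where
  interchange : ∀ a b c d → (a + b) + (c + d) ≡ (a + c) + (b + d)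
  interchange = solve-∀

∑-distrib-- : (f g : Fin n → ℤ) → ∑ (λ k → f k - g k) ≡ ∑ f - ∑ g
∑-distrib-- {zero}  f g = refl
∑-distrib-- {suc n} f g =
  trans (cong (f zero - g zero +_) (∑-distrib-- (f ∘ suc) (g ∘ suc)))
        (interchange (f zero) (g zero) (∑ (f ∘ suc)) (∑ (g ∘ suc)))
  where
  interchange : ∀ a b c d → (a - b) + (c - d) ≡ (a + c) - (b + d)
  interchange = solve-∀

δ-no : {i j : Fin n} → i ≢ j → δ i j ≡ 0ℤ
δ-no {i = i} {j} i≢j with i ≟ j
... | yes i≡j = ⊥-elim (i≢j i≡j)
... | no _    = refl

δ-suc : (i j : Fin n) → δ (suc i) (suc j) ≡ δ i j
δ-suc i j with i ≟ j
... | yes _ = refl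
... | no _  = refl

δ-*-swap : (f : Fin n → ℤ) (i j : Fin n) → δ i j * f i ≡ δ j i * f j
δ-*-swap f i j = case i ≟ j of λ where
  (yes refl) → refl
  (no i≢j)   → trans (cong (_* f i) (δ-no i≢j)) (sym (cong (_* f j) (δ-no (i≢j ∘ sym))))

∑-δ : (i : Fin n) (f : Fin n → ℤ) → ∑ (λ k → δ i k * f k) ≡ f i
∑-δ zero f =
  trans (cong₂ _+_ (*-identityˡ (f zero)) (∑-zero (λ k → 0ℤ * f (suc k)) (λ _ → refl)))
        (+-identityʳ (f zero))
∑-δ (suc i) f =
  trans (+-identityˡ _)
        (trans (∑-cong (λ k → cong (_* f (suc k)) (δ-suc i k))) (∑-δ i (f ∘ suc)))

i≡j⇒i-j≡0 : {i j : ℤ} → i ≡ j → i - j ≡ 0ℤ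
i≡j⇒i-j≡0 {i} refl = +-inverseʳ i

∀²⇔diagonal×offDiagonal : {P : Fin n → Fin n → Set} →
  (∀ i j → P i j) ⇔ ((∀ i → P i i) × (∀ i j → i ≢ j → P i j))
∀²⇔diagonal×offDiagonal {P = P} = mk⇔ (λ h → (λ i → h i i) , (λ i j _ → h i j)) from
  where
  from : (∀ i → P i i) × (∀ i j → i ≢ j → P i j) → ∀ i j → P i j
  from (diagonal , offDiagonal) i j with i ≟ j
  ... | yes refl = diagonal i
  ... | no i≢j   = offDiagonal i j i≢j

∑≠-vanishing : (i j : Fin n) (f : Fin n → ℤ) → f i ≡ 0ℤ → f j ≡ 0ℤ → ∑≠ i j f ≡ ∑ f
∑≠-vanishing i j f fi≡0 fj≡0 = ∑-cong weight
  where
  killed : ∀ k → f k ≡ 0ℤ → (1ℤ - δ k i) * (1ℤ - δ k j) * f k ≡ f k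
  killed k fk≡0 = begin
    (1ℤ - δ k i) * (1ℤ - δ k j) * f k ≡⟨ cong ((1ℤ - δ k i) * (1ℤ - δ k j) *_) fk≡0 ⟩
    (1ℤ - δ k i) * (1ℤ - δ k j) * 0ℤ  ≡⟨ *-zeroʳ ((1ℤ - δ k i) * (1ℤ - δ k j)) ⟩
    0ℤ                                ≡⟨ sym fk≡0 ⟩
    f k                               ∎
    where open ≡-Reasoning
  weight : ∀ k → (1ℤ - δ k i) * (1ℤ - δ k j) * f k ≡ f k
  weight k = case ((k ≟ i) , (k ≟ j)) of λ where
    (yes refl , _)        → killed k fi≡0
    (no _     , yes refl) → killed k fj≡0
    (no k≢i   , no k≢j)   →
      trans (cong₂ (λ x y → (1ℤ - x) * (1ℤ - y) * f k) (δ-no k≢i) (δ-no k≢j)) (*-identityˡ (f k))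

-- laplacian Γ is definitionally diagMinus (outdeg Γ) (adj Γ).
diagMinus : (Fin n → ℤ) → Matrix n → Matrix n
diagMinus d M i j = δ i j * d i - M i j

diagMinus-·-transpose : (d : Fin n → ℤ) (M : Matrix n) (i j : Fin n) →
  (diagMinus d M · transpose (diagMinus d M)) i j
    ≡ d i * (δ j i * d j - M j i) - M i j * d j + (M · transpose M) i j
diagMinus-·-transpose d M i j = begin
  ∑ (λ k → (δ i k * d i - M i k) * (δ j k * d j - M j k))
    ≡⟨ ∑-cong (λ k → expand (δ i k) (δ j k) (d i) (d j) (M i k) (M j k)) ⟩
  ∑ (λ k → row k - column k + M i k * M j k)
    ≡⟨ ∑-distrib-+ (λ k → row k - column k) (λ k → M i k * M j k) ⟩
  ∑ (λ k → row k - column k) + (M · transpose M) i j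
    ≡⟨ cong (_+ (M · transpose M) i j) (∑-distrib-- row column) ⟩
  ∑ row - ∑ column + (M · transpose M) i j
    ≡⟨ cong (_+ (M · transpose M) i j) (cong₂ _-_ (∑-δ i _) (∑-δ j _)) ⟩
  d i * (δ j i * d j - M j i) - M i j * d j + (M · transpose M) i j ∎
  where
  open ≡-Reasoning
  row column : Fin _ → ℤ
  row    k = δ i k * (d i * (δ j k * d j - M j k))
  column k = δ j k * (M i k * d j)
  expand : ∀ δi δj di dj mi mj →
    (δi * di - mi) * (δj * dj - mj) ≡ δi * (di * (δj * dj - mj)) - δj * (mi * dj) + mi * mj
  expand = solve-∀

transpose-diagMinus : (d : Fin n → ℤ) (M : Matrix n) (i j : Fin n) →
  transpose (diagMinus d M) i j ≡ diagMinus d (transpose M) i j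
transpose-diagMinus d M i j = cong (_- M j i) (δ-*-swap d j i)

transpose-·-diagMinus : (d : Fin n → ℤ) (M : Matrix n) (i j : Fin n) →
  (transpose (diagMinus d M) · diagMinus d M) i j
    ≡ d i * (δ j i * d j - M i j) - M j i * d j + (transpose M · M) i j
transpose-·-diagMinus d M i j =
  trans (∑-cong (λ k → cong₂ _*_ (transpose-diagMinus d M i k) (transpose-diagMinus d M j k)))
        (diagMinus-·-transpose d (transpose M) i j)

diagMinus-commutator : (d : Fin n → ℤ) (M : Matrix n) (i j : Fin n) →
  let N = diagMinus d M in
  (N · transpose N) i j - (transpose N · N) i j
    ≡ ((M · transpose M) i j - (transpose M · M) i j) - (M i j - M j i) * (d j - d i)
diagMinus-commutator d M i j =
  trans (cong₂ _-_ (diagMinus-·-transpose d M i j) (transpose-·-diagMinus d M i j))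
        (cancel (d i) (d j) (δ j i) (M i j) (M j i) ((M · transpose M) i j) ((transpose M · M) i j))
  where
  cancel : ∀ di dj δji mij mji s t →
    (di * (δji * dj - mji) - mij * dj + s) - (di * (δji * dj - mij) - mji * dj + t)
      ≡ (s - t) - (mij - mji) * (dj - di)
  cancel = solve-∀

isNormal-diagMinus⇔ : (d : Fin n → ℤ) (M : Matrix n) →
  IsNormalMatrix (diagMinus d M)
    ⇔ (∀ i j → (M i j - M j i) * (d j - d i) ≡ (M · transpose M) i j - (transpose M · M) i j)
isNormal-diagMinus⇔ d M = mk⇔
  (λ normal i j → sym (i-j≡0⇒i≡j _ _
    (trans (sym (diagMinus-commutator d M i j)) (i≡j⇒i-j≡0 (normal i j)))))
  (λ commutes i j → i-j≡0⇒i≡j _ _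
    (trans (diagMinus-commutator d M i j) (i≡j⇒i-j≡0 (sym (commutes i j)))))

bool→ℤ-*-idem : (b : Bool) → bool→ℤ b * bool→ℤ b ≡ bool→ℤ b
bool→ℤ-*-idem true  = refl
bool→ℤ-*-idem false = refl

module _ (Γ : Digraph n) where

  private
    A = adj Γ

  adj-loop : (i : Fin n) → A i i ≡ 0ℤ
  adj-loop i = cong bool→ℤ (noLoop Γ i)

  adj-·-transpose-diagonal : (i : Fin n) → (A · transpose A) i i ≡ outdeg Γ i
  adj-·-transpose-diagonal i = ∑-cong (λ k → bool→ℤ-*-idem (edge Γ i k))

  transpose-·-adj-diagonal : (i : Fin n) → (transpose A · A) i i ≡ indeg Γ i
  transpose-·-adj-diagonal i = ∑-cong (λ k → bool→ℤ-*-idem (edge Γ k i))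

  ∑≠-adj-commutator : (i j : Fin n) →
    ∑≠ i j (λ k → A i k * A j k - A k i * A k j) ≡ (A · transpose A) i j - (transpose A · A) i j
  ∑≠-adj-commutator i j =
    trans (∑≠-vanishing i j _ at-i at-j) (∑-distrib-- (λ k → A i k * A j k) (λ k → A k i * A k j))
    where
    -- 0ℤ * x reduces to 0ℤ, while x * 0ℤ needs *-zeroʳ.
    at-i : A i i * A j i - A i i * A i j ≡ 0ℤ
    at-i = cong₂ (λ x y → x * A j i - y * A i j) (adj-loop i) (adj-loop i)
    at-j : A i j * A j j - A j i * A j j ≡ 0ℤ
    at-j = trans (cong₂ (λ x y → A i j * x - A j i * y) (adj-loop j) (adj-loop j))
                 (cong₂ _-_ (*-zeroʳ (A i j)) (*-zeroʳ (A j i)))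

  commutes-diagonal⇔balanced :
    (∀ i → (A i i - A i i) * (outdeg Γ i - outdeg Γ i) ≡ (A · transpose A) i i - (transpose A · A) i i)
      ⇔ IsBalanced Γ
  commutes-diagonal⇔balanced = mk⇔
    (λ commutes i → sym (i-j≡0⇒i≡j _ _ (sym (trans (sym (trivial i)) (trans (commutes i) (degrees i))))))
    (λ balanced i → trans (trivial i) (trans (sym (i≡j⇒i-j≡0 (sym (balanced i)))) (sym (degrees i))))
    where
    trivial : ∀ i → (A i i - A i i) * (outdeg Γ i - outdeg Γ i) ≡ 0ℤ
    trivial i = cong (_* (outdeg Γ i - outdeg Γ i)) (+-inverseʳ (A i i))
    degrees : ∀ i → (A · transpose A) i i - (transpose A · A) i i ≡ outdeg Γ i - indeg Γ i
    degrees i = cong₂ _-_ (adj-·-transpose-diagonal i) (transpose-·-adj-diagonal i)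

  commutes-offDiagonal⇔condition :
    (∀ i j → i ≢ j →
      (A i j - A j i) * (outdeg Γ j - outdeg Γ i) ≡ (A · transpose A) i j - (transpose A · A) i j)
      ⇔ Condition Γ
  commutes-offDiagonal⇔condition = mk⇔
    (λ commutes i j i≢j → trans (commutes i j i≢j) (sym (∑≠-adj-commutator i j)))
    (λ condition i j i≢j → trans (condition i j i≢j) (∑≠-adj-commutator i j))

proposition3p4 : (n : ℕ) (Γ : Digraph n) → IsNormal Γ ⇔ (IsBalanced Γ × Condition Γ)
proposition3p4 n Γ =
  ⇔-trans (isNormal-diagMinus⇔ (outdeg Γ) (adj Γ))
  (⇔-trans ∀²⇔diagonal×offDiagonal
           (commutes-diagonal⇔balanced Γ ×-⇔ commutes-offDiagonal⇔condition Γ))
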